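{- Let $n\ge 1$ and $w\in W_n$, and let $\iota(w)\in S_{2n+1}$ be $w$ regarded as a permutation of $\{\bar n,\dots,n\}$. Then for all integers $k,p,q$, the triple $(k,p,q)$ lies in the type A essential set $\mathcal{E}\mathrm{ss}(\iota(w))$ if and only if its reflection $(k,p,q)^\perp=(k+p+q-1,\ \bar p+1,\ \bar q+1)$ lies in $\mathcal{E}\mathrm{ss}(\iota(w))$.
   Context: Write $\bar m$ for $-m$. $W_n$ is the group of signed permutations: bijections $w$ of $\{\bar n,\dots,\bar 1,0,1,\dots,n\}$ with $w(\bar\imath)=\overline{w(i)}$ for all $i$ (so $w(0)=0$). $S_{2n+1}$ denotes the group of all permutations of $\{\bar n,\dots,n\}$, and $\iota\colon W_n\hookrightarrow S_{2n+1}$ is the inclusion. For $v\in S_{2n+1}$ (extended by $v(m)=m$ for $|m|>n$), its type A rank function is $r_v(p,q)=\#\{i\le \bar p : v(i)\ge q\}$. A pair $(a,b)$ with $a,b\in\{\bar n,\dots,n\}$ is a southeast corner of the diagram of $v$ if $v^{ -1}(a)>b$, $v(b)>a$, $v^{ -1}(a+1)\le b$ and $v(b+1)\le a$. The (type A) essential set $\mathcal{E}\mathrm{ss}(v)$ is the set of triples $(k,p,q)$ such that $(q-1,\bar p)$ is a southeast corner of the diagram of $v$ and $k=r_v(p,q)$. -}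

module Defs where

open import Data.Nat as ℕ using (ℕ)
open import Data.Integer using (ℤ; +_; -_; _+_; _-_; _≤_; _<_; _≥_; _>_; _≤?_; ∣_∣)
open import Data.List using (List; map; upTo; filter; length)
open import Data.Product using (_×_)
open import Relation.Nullary.Decidable using (_×-dec_)
open import Relation.Binary.PropositionalEquality using (_≡_)

-- A permutation of {n̄,…,n} (an element of S_{2n+1}), regarded as a
-- bijection of ℤ extended by the identity outside {n̄,…,n}.
record Perm (n : ℕ) : Set where
  field
    fun     : ℤ → ℤ
    inv     : ℤ → ℤ
    inv-fun : ∀ i → inv (fun i) ≡ i
    fun-inv : ∀ i → fun (inv i) ≡ i
    fixes   : ∀ i → n ℕ.< ∣ i ∣ → fun i ≡ i
open Perm public

record SignedPerm (n : ℕ) : Set where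
  field
    perm : Perm n
    odd  : ∀ i → fun perm (- i) ≡ - fun perm i
open SignedPerm public

ι : ∀ {n} → SignedPerm n → Perm n
ι w = perm w

symRange : ℕ → List ℤ
symRange M = map (λ j → (- (+ M)) + (+ j)) (upTo (2 ℕ.* M ℕ.+ 1))

-- Type A rank function r_v(p,q) = #{ i ≤ p̄ : v(i) ≥ q }.
-- Every such i lies in [-(n+|p|+|q|), n+|p|+|q|] (since v is the identity
-- outside {n̄,…,n}), so counting over that range is exact.
rank : ∀ {n} → Perm n → ℤ → ℤ → ℕ
rank {n} v p q =
  length (filter (λ i → (i ≤? - p) ×-dec (q ≤? fun v i))
                 (symRange (n ℕ.+ ∣ p ∣ ℕ.+ ∣ q ∣)))

InRange : ℕ → ℤ → Set
InRange n a = (- (+ n) ≤ a) × (a ≤ + n)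

SECorner : ∀ {n} → Perm n → ℤ → ℤ → Set
SECorner {n} v a b =
  InRange n a × InRange n b ×
  (inv v a > b) × (fun v b > a) ×
  (inv v (a + + 1) ≤ b) × (fun v (b + + 1) ≤ a)

InEss : ∀ {n} → Perm n → ℤ → ℤ → ℤ → Set
InEss v k p q = SECorner v (q - + 1) (- p) × (k ≡ + rank v p q)

-- Write p' = p̄+1, q' = q̄+1 and v = ι(w).  The reflection acts on the two
-- halves of the condition (k,p,q) ∈ Ess(v) separately:
--
-- Let mirror(x) = x̄-1.  The corner (q-1, p̄) attached to (k,p,q)
--    is sent to the corner (q'-1, p̄') = (mirror(q-1), mirror(p̄)) attached to
--    the reflected triple, and since w and w⁻¹ commute with negation,
--    mirroring both coordinates maps southeast corners of v to southeast
--    corners.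
--
-- Inside a large window {N̄,…,N} split positions i by i ≤ p̄ and
--    values by v(i) ≥ q.  Negating positions and values turns r_v(p',q') into
--    the number of i > p̄ with v(i) < q.  The column {i ≤ p̄} has p̄+1+N
--    elements and, v being a bijection of the window, the row {v(i) < q} has
--    q+N; inclusion–exclusion then gives r_v(p',q') = r_v(p,q) + p + q - 1.
module Submission where

open import Defs
open import Data.Nat using (ℕ)
open import Data.Integer using (ℤ; +_; -_; _+_; _-_)
open import Function.Bundles using (_⇔_; mk⇔; Equivalence)
import Data.Nat as ℕ
import Data.Nat.Properties as ℕP
open import Data.Integer using (-[1+_]; -≤+; _≤_; _<_; _≤?_; ∣_∣; +≤+; +<+)
open import Data.Integer.Properties
open import Data.Integer.Tactic.RingSolver using (solve-∀)
import Data.Nat.Tactic.RingSolver as ℕSolver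
open import Data.List using (List; []; _∷_; map; upTo; filter; length)
open import Data.List.Properties using (length-map; length-upTo; filter-≐)
open import Data.List.Membership.Propositional using (_∈_)
open import Data.List.Membership.Propositional.Properties
  using (∈-map⁺; ∈-map⁻; ∈-filter⁺; ∈-filter⁻; ∈-upTo⁺; ∈-upTo⁻)
open import Data.List.Membership.Propositional.Properties.WithK using (unique∧set⇒bag)
open import Data.List.Relation.Unary.Unique.Propositional using (Unique)
import Data.List.Relation.Unary.Unique.Propositional.Properties as Unique
open import Data.List.Relation.Binary.BagAndSetEquality using (∼bag⇒↭)
open import Data.List.Relation.Binary.Permutation.Propositional.Properties using (↭-length)
open import Data.Product using (_×_; _,_; proj₁; proj₂; Σ; swap)
open import Level using (0ℓ)
open import Relation.Binary.PropositionalEquality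
open import Relation.Nullary using (¬_; yes; no; Dec)
open import Relation.Nullary.Decidable using (_×-dec_)
open import Relation.Unary using (Pred; Decidable; _≐_)
open import Relation.Unary.Properties using (_∩?_; ∁?)

count : {A : Set} {P : Pred A 0ℓ} → Decidable P → List A → ℕ
count P? xs = length (filter P? xs)

unique-length : {A : Set} {xs ys : List A} → Unique xs → Unique ys →
  (∀ {x} → x ∈ xs ⇔ x ∈ ys) → length xs ≡ length ys
unique-length u v e = ↭-length (∼bag⇒↭ (unique∧set⇒bag u v e))

count-split : {A : Set} {P Q : Pred A 0ℓ} (P? : Decidable P) (Q? : Decidable Q) (xs : List A) →
  count P? xs ≡ count (P? ∩? Q?) xs ℕ.+ count (P? ∩? ∁? Q?) xs
count-split P? Q? [] = refl
count-split P? Q? (x ∷ xs) with P? x | Q? x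
... | no _  | _     = count-split P? Q? xs
... | yes _ | yes _ = cong ℕ.suc (count-split P? Q? xs)
... | yes _ | no _  = trans (cong ℕ.suc (count-split P? Q? xs)) (sym (ℕP.+-suc _ _))

count-∩-comm : {A : Set} {P Q : Pred A 0ℓ} (P? : Decidable P) (Q? : Decidable Q) (xs : List A) →
  count (P? ∩? Q?) xs ≡ count (Q? ∩? P?) xs
count-∩-comm P? Q? xs = cong length (filter-≐ (P? ∩? Q?) (Q? ∩? P?) (swap , swap) xs)

count-bijection : {A : Set} {P Q : Pred A 0ℓ} (P? : Decidable P) (Q? : Decidable Q)
  {xs : List A} (h h⁻¹ : A → A) →
  (∀ x → h⁻¹ (h x) ≡ x) → (∀ y → h (h⁻¹ y) ≡ y) →
  (∀ {x} → x ∈ xs → h x ∈ xs) → (∀ {y} → y ∈ xs → h⁻¹ y ∈ xs) →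
  (∀ x → P x → Q (h x)) → (∀ y → Q y → P (h⁻¹ y)) →
  Unique xs → count P? xs ≡ count Q? xs
count-bijection P? Q? {xs} h h⁻¹ h⁻¹∘h h∘h⁻¹ h∈ h⁻¹∈ P⇒Qh Q⇒Ph⁻¹ u = begin
  count P? xs                  ≡⟨ length-map h (filter P? xs) ⟨
  length (map h (filter P? xs)) ≡⟨ unique-length hP-unique (Unique.filter⁺ Q? u) (mk⇔ to from) ⟩
  count Q? xs                  ∎
  where
  open ≡-Reasoning
  hP-unique : Unique (map h (filter P? xs))
  hP-unique = Unique.map⁺ (λ {x} {y} e → trans (sym (h⁻¹∘h x)) (trans (cong h⁻¹ e) (h⁻¹∘h y)))
                          (Unique.filter⁺ P? u)
  to : ∀ {y} → y ∈ map h (filter P? xs) → y ∈ filter Q? xs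
  to y∈ with ∈-map⁻ h y∈
  ... | x , x∈ , refl with ∈-filter⁻ P? {xs = xs} x∈
  ... | x∈xs , Px = ∈-filter⁺ Q? (h∈ x∈xs) (P⇒Qh x Px)
  from : ∀ {y} → y ∈ filter Q? xs → y ∈ map h (filter P? xs)
  from {y} y∈ with ∈-filter⁻ Q? {xs = xs} y∈
  ... | y∈xs , Qy = subst (_∈ map h (filter P? xs)) (h∘h⁻¹ y)
                          (∈-map⁺ h (∈-filter⁺ P? (h⁻¹∈ y∈xs) (Q⇒Ph⁻¹ y Qy)))

≤⇒<+1 : ∀ {x y} → x ≤ y → x < y + + 1
≤⇒<+1 {x} {y} x≤y = ≤-<-trans x≤y (subst (_< y + + 1) (+-identityʳ y) (+-monoʳ-< y (+<+ (ℕ.s≤s ℕ.z≤n))))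

<+1⇒≤ : ∀ {x y} → x < y + + 1 → x ≤ y
<+1⇒≤ {x} {y} x<y+1 = subst₂ _≤_ (cancel x) (cancel y) (+-monoʳ-≤ (- + 1) 1+x≤y+1)
  where
  cancel : ∀ z → - + 1 + (z + + 1) ≡ z
  cancel = solve-∀
  1+x≤y+1 : x + + 1 ≤ y + + 1
  1+x≤y+1 = subst (_≤ y + + 1) (+-comm (+ 1) x) (i<j⇒suc[i]≤j x<y+1)

neg-+-cancel : ∀ L z → - L + (L + z) ≡ z
neg-+-cancel = solve-∀

+-cancelˡ-≡ : ∀ L {x y} → L + x ≡ L + y → x ≡ y
+-cancelˡ-≡ L {x} {y} e = subst₂ _≡_ (neg-+-cancel L x) (neg-+-cancel L y) (cong (λ z → - L + z) e)

+-cancelˡ-≤ : ∀ L {x y} → L + x ≤ L + y → x ≤ y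
+-cancelˡ-≤ L {x} {y} le = subst₂ _≤_ (neg-+-cancel L x) (neg-+-cancel L y) (+-monoʳ-≤ (- L) le)

+-cancelˡ-< : ∀ L {x y} → L + x < L + y → x < y
+-cancelˡ-< L {x} {y} lt = subst₂ _<_ (neg-+-cancel L x) (neg-+-cancel L y) (+-monoʳ-< (- L) lt)

≤⇒offset : ∀ {x y} → x ≤ y → Σ ℕ (λ d → y ≡ x + + d)
≤⇒offset {x} {y} x≤y = ∣ y - x ∣ , sym (begin
  x + + ∣ y - x ∣ ≡⟨ cong (λ z → x + z) (0≤i⇒+∣i∣≡i (i≤j⇒0≤j-i x≤y)) ⟩
  x + (y - x)     ≡⟨ shift x y ⟩
  y               ∎)
  where
  open ≡-Reasoning
  shift : ∀ x y → x + (y - x) ≡ y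
  shift = solve-∀

<⇔+1≤ : ∀ {c x} → c < x ⇔ c + + 1 ≤ x
<⇔+1≤ {c} {x} = mk⇔ (λ c<x → subst (_≤ x) (+-comm (+ 1) c) (i<j⇒suc[i]≤j c<x))
                    (λ c+1≤x → <-≤-trans (≤⇒<+1 ≤-refl) c+1≤x)

neg-<ˡ : ∀ {x y} → - x < y → - y < x
neg-<ˡ {x} {y} -x<y = subst (- y <_) (neg-involutive x) (neg-mono-< -x<y)

≤-reflect : ∀ {c x} → x ≤ - (c + + 1) ⇔ c < - x
≤-reflect {c} {x} = mk⇔
  (λ x≤ → Equivalence.from <⇔+1≤ (subst (_≤ - x) (neg-involutive (c + + 1)) (neg-mono-≤ x≤)))
  (λ c< → subst (_≤ - (c + + 1)) (neg-involutive x) (neg-mono-≤ (Equivalence.to <⇔+1≤ c<)))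

≥-reflect : ∀ {b y} → - b + + 1 ≤ y ⇔ - y < b
≥-reflect {b} {y} = mk⇔
  (λ ≤y → neg-<ˡ (Equivalence.from <⇔+1≤ ≤y))
  (λ <b → Equivalence.to <⇔+1≤ (neg-<ˡ <b))

-- The interval L, L+1, …, L+m-1.  Note that symRange M = interval (-M) (2M+1).
interval : ℤ → ℕ → List ℤ
interval L m = map (λ j → L + + j) (upTo m)

interval-unique : ∀ L m → Unique (interval L m)
interval-unique L m = Unique.map⁺ (λ {i} {j} e → +-injective (+-cancelˡ-≡ L e)) (Unique.upTo⁺ m)

length-interval : ∀ L m → length (interval L m) ≡ m
length-interval L m = trans (length-map _ (upTo m)) (length-upTo m)

∈-interval⁻ : ∀ {L m x} → x ∈ interval L m → (L ≤ x) × (x < L + + m)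
∈-interval⁻ {L} {m} x∈ with ∈-map⁻ (λ j → L + + j) x∈
... | j , j<m , refl = i≤i+j L (+ j) , +-monoʳ-< L (+<+ (∈-upTo⁻ j<m))

∈-interval⁺ : ∀ {L m x} → L ≤ x → x < L + + m → x ∈ interval L m
∈-interval⁺ {L} {m} L≤x x< with ≤⇒offset L≤x
... | d , refl = ∈-map⁺ (λ j → L + + j) (∈-upTo⁺ (drop‿+<+ (+-cancelˡ-< L x<)))

count-initial : {P : Pred ℤ 0ℓ} (P? : Decidable P) (L : ℤ) (m d : ℕ) → d ℕ.≤ m →
  P ≐ (λ x → x < L + + d) → count P? (interval L m) ≡ d
count-initial P? L m d d≤m (P⇒< , <⇒P) =
  trans (unique-length (Unique.filter⁺ P? (interval-unique L m)) (interval-unique L d) (mk⇔ to from))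
        (length-interval L d)
  where
  to : ∀ {x} → x ∈ filter P? (interval L m) → x ∈ interval L d
  to x∈ with ∈-filter⁻ P? {xs = interval L m} x∈
  ... | x∈L+m , Px = ∈-interval⁺ {L} {d} (proj₁ (∈-interval⁻ {L} {m} x∈L+m)) (P⇒< Px)
  from : ∀ {x} → x ∈ interval L d → x ∈ filter P? (interval L m)
  from x∈ with ∈-interval⁻ {L} {d} x∈
  ... | L≤x , x< = ∈-filter⁺ P? (∈-interval⁺ {L} {m} L≤x (<-≤-trans x< (+-monoʳ-≤ L (+≤+ d≤m)))) (<⇒P x<)

InRange? : ∀ M x → Dec (InRange M x)
InRange? M x = (- (+ M) ≤? x) ×-dec (x ≤? + M)

InRange-widen : ∀ {M M' x} → M ℕ.≤ M' → InRange M x → InRange M' x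
InRange-widen M≤M' (lo , hi) = ≤-trans (neg-mono-≤ (+≤+ M≤M')) lo , ≤-trans hi (+≤+ M≤M')

InRange-neg : ∀ {M x} → InRange M x → InRange M (- x)
InRange-neg {M} (lo , hi) = neg-mono-≤ hi , subst (_ ≤_) (neg-involutive (+ M)) (neg-mono-≤ lo)

InRange-abs : ∀ {M x} → ∣ x ∣ ℕ.≤ M → InRange M x
InRange-abs {M} {x} ∣x∣≤M = InRange-widen ∣x∣≤M (lower x , upper x)
  where
  lower : ∀ x → - (+ ∣ x ∣) ≤ x
  lower (+ k)    = neg-≤-pos
  lower -[1+ k ] = ≤-refl
  upper : ∀ x → x ≤ + ∣ x ∣
  upper (+ k)    = ≤-refl
  upper -[1+ k ] = -≤+

¬InRange⇒> : ∀ n x → ¬ InRange n x → n ℕ.< ∣ x ∣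
¬InRange⇒> n x x∉ = ℕP.≰⇒> (λ ∣x∣≤n → x∉ (InRange-abs ∣x∣≤n))

symRange-end : ∀ M → - (+ M) + + (2 ℕ.* M ℕ.+ 1) ≡ + M + + 1
symRange-end M = trans (cong (λ z → - (+ M) + + (M ℕ.+ z ℕ.+ 1)) (ℕP.+-identityʳ M)) (double (+ M))
  where
  double : ∀ m → - m + (m + m + + 1) ≡ m + + 1
  double = solve-∀

symRange-unique : ∀ M → Unique (symRange M)
symRange-unique M = interval-unique (- (+ M)) (2 ℕ.* M ℕ.+ 1)

∈-symRange⁻ : ∀ {M x} → x ∈ symRange M → InRange M x
∈-symRange⁻ {M} x∈ with ∈-interval⁻ { - (+ M)} {2 ℕ.* M ℕ.+ 1} x∈
... | lo , hi = lo , <+1⇒≤ (subst (_ <_) (symRange-end M) hi)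

∈-symRange⁺ : ∀ {M x} → InRange M x → x ∈ symRange M
∈-symRange⁺ {M} (lo , hi) =
  ∈-interval⁺ { - (+ M)} {2 ℕ.* M ℕ.+ 1} lo (subst (_ <_) (sym (symRange-end M)) (≤⇒<+1 hi))

count-window : {P : Pred ℤ 0ℓ} (P? : Decidable P) {M M' : ℕ} → M ℕ.≤ M' →
  (∀ {x} → P x → InRange M x) → count P? (symRange M) ≡ count P? (symRange M')
count-window P? {M} {M'} M≤M' supp =
  unique-length (Unique.filter⁺ P? (symRange-unique M)) (Unique.filter⁺ P? (symRange-unique M')) (mk⇔ to from)
  where
  to : ∀ {x} → x ∈ filter P? (symRange M) → x ∈ filter P? (symRange M')
  to x∈ with ∈-filter⁻ P? {xs = symRange M} x∈
  ... | x∈M , Px = ∈-filter⁺ P? (∈-symRange⁺ (InRange-widen M≤M' (∈-symRange⁻ x∈M))) Px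
  from : ∀ {x} → x ∈ filter P? (symRange M') → x ∈ filter P? (symRange M)
  from x∈ with ∈-filter⁻ P? {xs = symRange M'} x∈
  ... | _ , Px = ∈-filter⁺ P? (∈-symRange⁺ (supp Px)) Px

count-below : {P : Pred ℤ 0ℓ} (P? : Decidable P) (M : ℕ) (t : ℤ) →
  - (+ M) ≤ t → t ≤ + M + + 1 → P ≐ (λ x → x < t) → + count P? (symRange M) ≡ t + + M
count-below P? M t lo hi P≐ with ≤⇒offset lo
... | d , refl = begin
  + count P? (symRange M)  ≡⟨ cong +_ (count-initial P? (- (+ M)) (2 ℕ.* M ℕ.+ 1) d d≤ P≐) ⟩
  + d                      ≡⟨ offset (+ M) (+ d) ⟩
  - (+ M) + + d + + M      ∎
  where
  open ≡-Reasoning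
  offset : ∀ m d → d ≡ - m + d + m
  offset = solve-∀
  d≤ : d ℕ.≤ 2 ℕ.* M ℕ.+ 1
  d≤ = drop‿+≤+ (+-cancelˡ-≤ (- (+ M)) (subst (- (+ M) + + d ≤_) (sym (symRange-end M)) hi))

-- Permutations of {n̄,…,n}

_⁻¹ : ∀ {n} → Perm n → Perm n
v ⁻¹ = record
  { fun     = inv v
  ; inv     = fun v
  ; inv-fun = fun-inv v
  ; fun-inv = inv-fun v
  ; fixes   = λ i n<∣i∣ → trans (cong (inv v) (sym (fixes v i n<∣i∣))) (inv-fun v i)
  }

fixed-outside : ∀ {n} (v : Perm n) {x} → ¬ InRange n x → fun v x ≡ x
fixed-outside {n} v {x} x∉ = fixes v x (¬InRange⇒> n x x∉)

-- ... and therefore maps every window {N̄,…,N} ⊇ {n̄,…,n} onto itself.  If x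
-- is in {n̄,…,n} but v(x) is not, then x = v⁻¹(v(x)) = v(x), a contradiction.
fun-InRange : ∀ {n N} (v : Perm n) {x} → n ℕ.≤ N → InRange N x → InRange N (fun v x)
fun-InRange {n} {N} v {x} n≤N x∈N with InRange? n x
... | no x∉n = subst (InRange N) (sym (fixed-outside v x∉n)) x∈N
... | yes x∈n with InRange? n (fun v x)
...   | yes vx∈n = InRange-widen n≤N vx∈n
...   | no vx∉n  = subst (InRange N) (sym (trans (sym (fixed-outside (v ⁻¹) vx∉n)) (inv-fun v x))) x∈N

-- If a lies in {n̄,…,n} and v(a+1) ≤ b ≤ n, then a+1 lies in {n̄,…,n} too:
-- otherwise v(a+1) = a+1 = n+1 > b.
suc-InRange : ∀ {n} (v : Perm n) {a b} → InRange n a → InRange n b → fun v (a + + 1) ≤ b →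
  InRange n (a + + 1)
suc-InRange {n} v {a} (a-lo , _) (_ , b-hi) va+1≤b with InRange? n (a + + 1)
... | yes a+1∈n = a+1∈n
... | no a+1∉n  = ≤-trans a-lo (i≤i+j a (+ 1)) ,
                  ≤-trans (subst (_≤ _) (fixed-outside v a+1∉n) va+1≤b) b-hi

-- The points counted by r_v(p,q) lie in {K̄,…,K} for K = n+|p|+|q|: inside
-- {n̄,…,n} trivially, and outside it v(i) = i, so that q ≤ i ≤ p̄.
rank-support : ∀ {n} (v : Perm n) p q {i} → i ≤ - p → q ≤ fun v i →
  InRange (n ℕ.+ ∣ p ∣ ℕ.+ ∣ q ∣) i
rank-support {n} v p q {i} i≤p̄ q≤vi with InRange? n i
... | yes i∈n = InRange-widen (ℕP.≤-trans (ℕP.m≤m+n n ∣ p ∣) (ℕP.m≤m+n _ ∣ q ∣)) i∈n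
... | no i∉n  = ≤-trans (proj₁ (InRange-abs q-bound)) (subst (q ≤_) (fixed-outside v i∉n) q≤vi) ,
                ≤-trans i≤p̄ (proj₂ (InRange-abs p̄-bound))
  where
  q-bound : ∣ q ∣ ℕ.≤ n ℕ.+ ∣ p ∣ ℕ.+ ∣ q ∣
  q-bound = ℕP.m≤n+m ∣ q ∣ (n ℕ.+ ∣ p ∣)
  p̄-bound : ∣ - p ∣ ℕ.≤ n ℕ.+ ∣ p ∣ ℕ.+ ∣ q ∣
  p̄-bound = subst (ℕ._≤ n ℕ.+ ∣ p ∣ ℕ.+ ∣ q ∣) (sym (∣-i∣≡∣i∣ p)) (ℕP.≤-trans (ℕP.m≤n+m ∣ p ∣ n) (ℕP.m≤m+n _ ∣ q ∣))

rank-window : ∀ {n} (v : Perm n) p q {M} → n ℕ.+ ∣ p ∣ ℕ.+ ∣ q ∣ ℕ.≤ M →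
  rank v p q ≡ count (λ i → (i ≤? - p) ×-dec (q ≤? fun v i)) (symRange M)
rank-window v p q K≤M = count-window _ K≤M (λ i∈ → rank-support v p q (proj₁ i∈) (proj₂ i∈))

count-values : ∀ {n N} (v : Perm n) {Q : Pred ℤ 0ℓ} (Q? : Decidable Q) → n ℕ.≤ N →
  count (λ i → Q? (fun v i)) (symRange N) ≡ count Q? (symRange N)
count-values {N = N} v {Q} Q? n≤N =
  count-bijection (λ i → Q? (fun v i)) Q? (fun v) (inv v) (inv-fun v) (fun-inv v)
    (λ x∈ → ∈-symRange⁺ (fun-InRange v n≤N (∈-symRange⁻ x∈)))
    (λ y∈ → ∈-symRange⁺ (fun-InRange (v ⁻¹) n≤N (∈-symRange⁻ y∈)))
    (λ _ Qvx → Qvx) (λ y Qy → subst Q (sym (fun-inv v y)) Qy) (symRange-unique N)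

-- Signed permutations: the rank reflection

inv-odd : ∀ {n} (w : SignedPerm n) x → inv (ι w) (- x) ≡ - inv (ι w) x
inv-odd w x = begin
  g (- x)           ≡⟨ cong (λ y → g (- y)) (sym (fun-inv (ι w) x)) ⟩
  g (- f (g x))     ≡⟨ cong g (sym (odd w (g x))) ⟩
  g (f (- g x))     ≡⟨ inv-fun (ι w) (- g x) ⟩
  - g x             ∎
  where
  open ≡-Reasoning
  f g : ℤ → ℤ
  f = fun (ι w)
  g = inv (ι w)

-- Inclusion–exclusion for the quadrant counts a (north-west), c (south-west)
-- and b (south-east): the column a + c and the row c + b determine b - a.
quadrant-arith : ∀ a b c p q N → a + c ≡ - p + + 1 + N → c + b ≡ q + N → b ≡ a + p + q - + 1
quadrant-arith a b c p q N column row = begin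
  b                             ≡⟨ regroup a b c ⟩
  (c + b) - (a + c) + a         ≡⟨ cong₂ (λ r s → r - s + a) row column ⟩
  (q + N) - (- p + + 1 + N) + a ≡⟨ collect a p q N ⟩
  a + p + q - + 1               ∎
  where
  open ≡-Reasoning
  regroup : ∀ a b c → b ≡ (c + b) - (a + c) + a
  regroup = solve-∀
  collect : ∀ a p q N → (q + N) - (- p + + 1 + N) + a ≡ a + p + q - + 1
  collect = solve-∀

-- r_w(p̄+1, q̄+1) = r_w(p,q) + p + q - 1.  All counts are taken in the window
-- W = {N̄,…,N}, N = n+|p|+|q|+2, which is large enough for both ranks.
module _ {n : ℕ} (w : SignedPerm n) (p q : ℤ) where
  private
    v : Perm n
    v = ι w
    N : ℕ
    N = n ℕ.+ ∣ p ∣ ℕ.+ ∣ q ∣ ℕ.+ 2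
    W : List ℤ
    W = symRange N

    left? : Decidable (λ i → i ≤ - p)
    left? i = i ≤? - p
    up? : Decidable (λ i → q ≤ fun v i)
    up? i = q ≤? fun v i

    n≤N : n ℕ.≤ N
    n≤N = ℕP.≤-trans (ℕP.≤-trans (ℕP.m≤m+n n ∣ p ∣) (ℕP.m≤m+n _ ∣ q ∣)) (ℕP.m≤m+n _ 2)

    p̄∈W : InRange N (- p)
    p̄∈W = InRange-abs (subst (ℕ._≤ N) (sym (∣-i∣≡∣i∣ p))
            (ℕP.≤-trans (ℕP.≤-trans (ℕP.m≤n+m ∣ p ∣ n) (ℕP.m≤m+n _ ∣ q ∣)) (ℕP.m≤m+n _ 2)))

    q∈W : InRange N q
    q∈W = InRange-abs (ℕP.≤-trans (ℕP.m≤n+m ∣ q ∣ (n ℕ.+ ∣ p ∣)) (ℕP.m≤m+n _ 2))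

    reflected-bound : n ℕ.+ ∣ - p + + 1 ∣ ℕ.+ ∣ - q + + 1 ∣ ℕ.≤ N
    reflected-bound = ℕP.≤-trans (ℕP.+-mono-≤ (ℕP.+-monoʳ-≤ n (step p)) (step q))
                                 (ℕP.≤-reflexive (regroup n ∣ p ∣ ∣ q ∣))
      where
      step : ∀ x → ∣ - x + + 1 ∣ ℕ.≤ ∣ x ∣ ℕ.+ 1
      step x = subst (λ m → ∣ - x + + 1 ∣ ℕ.≤ m ℕ.+ 1) (∣-i∣≡∣i∣ x) (∣i+j∣≤∣i∣+∣j∣ (- x) (+ 1))
      regroup : ∀ a b c → a ℕ.+ (b ℕ.+ 1) ℕ.+ (c ℕ.+ 1) ≡ a ℕ.+ b ℕ.+ c ℕ.+ 2
      regroup = ℕSolver.solve-∀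

    north-west : rank v p q ≡ count (left? ∩? up?) W
    north-west = rank-window v p q (ℕP.m≤m+n _ 2)

    -- Negating positions and values identifies r_v(p̄+1, q̄+1) with the
    -- south-east quadrant {i > p̄, v(i) < q}.
    south-east : rank v (- p + + 1) (- q + + 1) ≡ count (∁? up? ∩? ∁? left?) W
    south-east = trans (rank-window v (- p + + 1) (- q + + 1) reflected-bound)
      (count-bijection _ (∁? up? ∩? ∁? left?) -_ -_ neg-involutive neg-involutive
        (λ x∈ → ∈-symRange⁺ (InRange-neg (∈-symRange⁻ {N} x∈)))
        (λ y∈ → ∈-symRange⁺ (InRange-neg (∈-symRange⁻ {N} y∈)))
        to from (symRange-unique N))
      where
      to : ∀ i → (i ≤ - (- p + + 1)) × (- q + + 1 ≤ fun v i) → ¬ (q ≤ fun v (- i)) × ¬ (- i ≤ - p)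
      to i (i≤ , ≤vi) = <⇒≱ (subst (_< q) (sym (odd w i)) (Equivalence.to ≥-reflect ≤vi)) ,
                        <⇒≱ (Equivalence.to ≤-reflect i≤)
      from : ∀ j → ¬ (q ≤ fun v j) × ¬ (j ≤ - p) → (- j ≤ - (- p + + 1)) × (- q + + 1 ≤ fun v (- j))
      from j (vj≱q , j≰p̄) =
        Equivalence.from ≤-reflect (subst (- p <_) (sym (neg-involutive j)) (≰⇒> j≰p̄)) ,
        subst (- q + + 1 ≤_) (sym (odd w j))
          (Equivalence.from ≥-reflect (subst (_< q) (sym (neg-involutive (fun v j))) (≰⇒> vj≱q)))

    column : + count left? W ≡ - p + + 1 + + N
    column = count-below left? N (- p + + 1)
      (≤-trans (proj₁ p̄∈W) (i≤i+j (- p) (+ 1))) (+-monoˡ-≤ (+ 1) (proj₂ p̄∈W)) (≤⇒<+1 , <+1⇒≤)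

    row : + count (∁? up?) W ≡ q + + N
    row = trans (cong +_ (count-values v (∁? (q ≤?_)) n≤N))
                (count-below (∁? (q ≤?_)) N q (proj₁ q∈W) (≤-trans (proj₂ q∈W) (i≤i+j (+ N) (+ 1)))
                             (≰⇒> , <⇒≱))

  rank-reflect : + rank (ι w) (- p + + 1) (- q + + 1) ≡ + rank (ι w) p q + p + q - + 1
  rank-reflect = begin
    + rank v (- p + + 1) (- q + + 1) ≡⟨ cong +_ south-east ⟩
    + se                            ≡⟨ quadrant-arith (+ nw) (+ se) (+ sw) p q (+ N) column′ row′ ⟩
    + nw + p + q - + 1              ≡⟨ cong (λ a → + a + p + q - + 1) north-west ⟨
    + rank v p q + p + q - + 1      ∎
    where
    open ≡-Reasoning
    nw sw se : ℕ
    nw = count (left? ∩? up?) W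
    sw = count (left? ∩? ∁? up?) W
    se = count (∁? up? ∩? ∁? left?) W
    column′ : + nw + + sw ≡ - p + + 1 + + N
    column′ = trans (cong +_ (sym (count-split left? up? W))) column
    row′ : + sw + + se ≡ q + + N
    row′ = trans (cong (λ c → + (c ℕ.+ se)) (count-∩-comm left? (∁? up?) W))
                 (trans (cong +_ (sym (count-split (∁? up?) left? W))) row)

-- Signed permutations: the corner reflection

-- Reflection of ℤ in the point -1/2.
mirror : ℤ → ℤ
mirror x = - (x + + 1)

mirror-< : (u : ℤ → ℤ) → (∀ x → u (- x) ≡ - u x) → ∀ {a b} →
  u (a + + 1) ≤ b → mirror b < u (mirror a)
mirror-< u u-odd {a} {b} ua+1≤b =
  subst (mirror b <_) (sym (u-odd (a + + 1))) (neg-mono-< (≤⇒<+1 ua+1≤b))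

mirror-≤ : (u : ℤ → ℤ) → (∀ x → u (- x) ≡ - u x) → ∀ {a b} →
  b < u a → u (mirror a + + 1) ≤ mirror b
mirror-≤ u u-odd {a} {b} b<ua =
  subst (_≤ mirror b) (trans (sym (u-odd a)) (cong u (sym (mirror-suc a))))
        (neg-mono-≤ (Equivalence.to <⇔+1≤ b<ua))
  where
  mirror-suc : ∀ a → - (a + + 1) + + 1 ≡ - a
  mirror-suc = solve-∀

corner-reflect : ∀ {n} (w : SignedPerm n) {a b} → SECorner (ι w) a b →
  SECorner (ι w) (mirror a) (mirror b)
corner-reflect w {a} {b} (a∈ , b∈ , b<ga , a<fb , ga+1≤b , fb+1≤a) =
  InRange-neg (suc-InRange (ι w ⁻¹) a∈ b∈ ga+1≤b) ,
  InRange-neg (suc-InRange (ι w) b∈ a∈ fb+1≤a) ,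
  mirror-< (inv (ι w)) (inv-odd w) {a} ga+1≤b ,
  mirror-< (fun (ι w)) (odd w) {b} fb+1≤a ,
  mirror-≤ (inv (ι w)) (inv-odd w) b<ga ,
  mirror-≤ (fun (ι w)) (odd w) a<fb

ess-reflect : ∀ {n} (w : SignedPerm n) {k p q} → InEss (ι w) k p q →
  InEss (ι w) (k + p + q - + 1) (- p + + 1) (- q + + 1)
ess-reflect w {k} {p} {q} (corner , k≡r) =
  subst (λ a → SECorner (ι w) a (mirror (- p))) (mirror-pred q) (corner-reflect w corner) ,
  trans (cong (λ z → z + p + q - + 1) k≡r) (sym (rank-reflect w p q))
  where
  mirror-pred : ∀ q → - (q - + 1 + + 1) ≡ (- q + + 1) - + 1
  mirror-pred = solve-∀

lemma1p1 : (n : ℕ) → 1 Data.Nat.≤ n → (w : SignedPerm n) → (k p q : ℤ) →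
    InEss (ι w) k p q ⇔ InEss (ι w) (k + p + q - + 1) (- p + + 1) (- q + + 1)
lemma1p1 n _ w k p q = mk⇔ (ess-reflect w) (λ h →
  subst (λ k → InEss (ι w) k p q) (k-back k p q)
    (subst₂ (InEss (ι w) _) (reflect-back p) (reflect-back q) (ess-reflect w h)))
  where
  -- the reflection is an involution
  reflect-back : ∀ p → - (- p + + 1) + + 1 ≡ p
  reflect-back = solve-∀
  k-back : ∀ k p q → (k + p + q - + 1) + (- p + + 1) + (- q + + 1) - + 1 ≡ k
  k-back = solve-∀
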